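{- Let $m\geq 2$, $n_1,\ldots,n_m\geq 2$ integers and $N=n_1\cdots n_m$. For every $\sigma\in Sym(m)$, the subgroups $K_{n_1,n_2,\ldots,n_m}$ and $K_{n_{\sigma^{ -1}(1)},n_{\sigma^{ -1}(2)},\ldots,n_{\sigma^{ -1}(m)}}$ of $Sym(\{0,\ldots,N-1\})$ coincide.
   Context: For positive integers $a,b$ and $1\le i\le a$, $1\le j\le b$, $E^{i,j}_{a\times b}$ denotes the $a\times b$ real matrix with entry $1$ in row $i$, column $j$ and $0$ elsewhere; $\otimes$ is the Kronecker product. For integers $k_1,\ldots,k_m\ge 2$ with product $N$ and $\rho\in Sym(m)$, the shuffling matrix is the $N\times N$ permutation matrix $$P^{\rho}_{k_1,\ldots,k_m}=\sum_{\substack{i_j=1,\ldots,k_j\\ j=1,\ldots,m}} E^{i_{\rho^{ -1}(1)},i_1}_{k_{\rho^{ -1}(1)}\times k_1}\otimes\cdots\otimes E^{i_{\rho^{ -1}(m)},i_m}_{k_{\rho^{ -1}(m)}\times k_m}.$$ Rows and columns of $N\times N$ matrices are indexed by $\{0,\ldots,N-1\}$; ${\bf e}_x$ is the column vector of length $N$ with $1$ at the position indexed by $x$. The permutation $\widetilde{\rho}$ of $\{0,\ldots,N-1\}$ induced by $P^{\rho}_{k_1,\ldots,k_m}$ is defined by $P^{\rho}_{k_1,\ldots,k_m}{\bf e}_x={\bf e}_{\widetilde{\rho}(x)}$. Define $K_{k_1,\ldots,k_m}=\langle \widetilde{\rho}:\ \rho\in Sym(m)\rangle\le Sym(\{0,\ldots,N-1\})$,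 the group generated by the permutations induced by all shuffling matrices $P^{\rho}_{k_1,\ldots,k_m}$. -}

module Defs where

open import Data.Nat using (ℕ; zero; suc; _+_; _*_)
open import Data.Fin using (Fin; toℕ) renaming (zero to fzero; suc to fsuc)
open import Data.Fin.Permutation using (Permutation′; _⟨$⟩ʳ_; _⟨$⟩ˡ_; id; flip; _∘ₚ_; _≈_)
open import Data.Product using (∃)
open import Relation.Binary.PropositionalEquality using (_≡_)

prodF : ∀ {m} → (Fin m → ℕ) → ℕ
prodF {zero}  k = 1
prodF {suc m} k = k fzero * prodF (λ j → k (fsuc j))

-- Mixed-radix encoding of a multi-index (0-based digits i_j < k_j), first
-- factor most significant: this is the 0-based row/column index of
-- E^{..} ⊗ ... ⊗ E^{..} in the Kronecker product.
encode : ∀ {m} (k : Fin m → ℕ) → ((j : Fin m) → Fin (k j)) → ℕ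
encode {zero}  k i = 0
encode {suc m} k i = toℕ (i fzero) * prodF (λ j → k (fsuc j))
                   + encode (λ j → k (fsuc j)) (λ j → i (fsuc j))

-- π (a permutation of {0,…,N-1}) is the permutation ρ̃ induced by the
-- shuffling matrix P^ρ_{k}:  P^ρ e_x = e_{ρ̃ x}, where column x corresponds to
-- the multi-index (i_1,…,i_m) w.r.t. radices (k_1,…,k_m) and the row is the
-- multi-index (i_{ρ⁻¹(1)},…,i_{ρ⁻¹(m)}) w.r.t. radices (k_{ρ⁻¹(1)},…,k_{ρ⁻¹(m)}).
IsShuffle : ∀ {m} (N : ℕ) (k : Fin m → ℕ) (ρ : Permutation′ m) → Permutation′ N → Set
IsShuffle N k ρ π =
  ∀ (x : Fin N) (i : (j : Fin _) → Fin (k j)) →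
    toℕ x ≡ encode k i →
    toℕ (π ⟨$⟩ʳ x) ≡ encode (λ j → k (ρ ⟨$⟩ˡ j)) (λ j → i (ρ ⟨$⟩ˡ j))

IsGenerator : ∀ {m} (N : ℕ) (k : Fin m → ℕ) → Permutation′ N → Set
IsGenerator N k π = ∃ λ ρ → IsShuffle N k ρ π

data InK {m} (N : ℕ) (k : Fin m → ℕ) : Permutation′ N → Set where
  gen  : ∀ {π} → IsGenerator N k π → InK N k π
  one  : InK N k id
  comp : ∀ {π τ} → InK N k π → InK N k τ → InK N k (π ∘ₚ τ)
  inv  : ∀ {π} → InK N k π → InK N k (flip π)
  ext  : ∀ {π τ} → InK N k π → π ≈ τ → InK N k τ

module Submission where

-- Write n′ for the reordered radices. A shuffle π for n equals h⁻¹ ∘ (h ∘ π),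
-- where h is the shuffle for n′ that reorders n′ back to n. Shuffles compose like
-- the permutations they come from (a reordering followed by a reordering is one
-- reordering), so h ∘ π is again a shuffle for n′. Hence every generator of K_n
-- lies in K_n′, and symmetrically. The shuffles exist at all because mixed-radix
-- encoding is a bijection between digit tuples and Fin (n₁ ⋯ nₘ).

open import Defs
open import Data.Nat using (ℕ; _≤_; zero; suc; _+_; _*_)
open import Data.Nat.Properties using (*-comm)
open import Data.Fin using (Fin; toℕ; cast; combine; remQuot) renaming (zero to fzero; suc to fsuc)
open import Data.Fin.Properties
  using (toℕ-injective; toℕ-cast; cast-is-id; toℕ-combine; remQuot-combine; combine-remQuot)
open import Data.Fin.Permutation
  using (Permutation; Permutation′; _⟨$⟩ˡ_; _⟨$⟩ʳ_; permutation; ↔⇒≡; cast-id; inverseˡ; inverseʳ; flip; _∘ₚ_)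
open import Data.Product using (_×_; _,_; proj₁; proj₂)
open import Function using (_∘_)
open import Relation.Binary.PropositionalEquality
open ≡-Reasoning

private
  variable
    m N : ℕ

Digits : (Fin m → ℕ) → Set
Digits k = (j : Fin _) → Fin (k j)

encodeFin : (k : Fin m → ℕ) → Digits k → Fin (prodF k)
encodeFin {zero}  k i = fzero
encodeFin {suc m} k i = combine (i fzero) (encodeFin (k ∘ fsuc) (i ∘ fsuc))

decodeFin : (k : Fin m → ℕ) → Fin (prodF k) → Digits k
decodeFin {suc m} k x fzero    = proj₁ (remQuot {k fzero} (prodF (k ∘ fsuc)) x)
decodeFin {suc m} k x (fsuc j) = decodeFin (k ∘ fsuc) (proj₂ (remQuot {k fzero} (prodF (k ∘ fsuc)) x)) j

toℕ-encodeFin : (k : Fin m → ℕ) (i : Digits k) → toℕ (encodeFin k i) ≡ encode k i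
toℕ-encodeFin {zero}  k i = refl
toℕ-encodeFin {suc m} k i = begin
  toℕ (combine (i fzero) (encodeFin (k ∘ fsuc) (i ∘ fsuc)))
    ≡⟨ toℕ-combine (i fzero) _ ⟩
  prodF (k ∘ fsuc) * toℕ (i fzero) + toℕ (encodeFin (k ∘ fsuc) (i ∘ fsuc))
    ≡⟨ cong₂ _+_ (*-comm (prodF (k ∘ fsuc)) _) (toℕ-encodeFin (k ∘ fsuc) (i ∘ fsuc)) ⟩
  encode k i ∎

encodeFin-cong : (k : Fin m → ℕ) {i i′ : Digits k} → (∀ j → i j ≡ i′ j) → encodeFin k i ≡ encodeFin k i′
encodeFin-cong {zero}  k eq = refl
encodeFin-cong {suc m} k eq = cong₂ combine (eq fzero) (encodeFin-cong (k ∘ fsuc) (eq ∘ fsuc))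

encodeFin-decodeFin : (k : Fin m → ℕ) (x : Fin (prodF k)) → encodeFin k (decodeFin k x) ≡ x
encodeFin-decodeFin {zero}  k fzero = refl
encodeFin-decodeFin {suc m} k x =
  trans (cong (combine (proj₁ split)) (encodeFin-decodeFin (k ∘ fsuc) (proj₂ split)))
        (combine-remQuot {k fzero} (prodF (k ∘ fsuc)) x)
  where split = remQuot {k fzero} (prodF (k ∘ fsuc)) x

decodeFin-encodeFin : (k : Fin m → ℕ) (i : Digits k) (j : Fin m) → decodeFin k (encodeFin k i) j ≡ i j
decodeFin-encodeFin {suc m} k i fzero    = cong proj₁ (remQuot-combine (i fzero) _)
decodeFin-encodeFin {suc m} k i (fsuc j) = trans
  (cong (λ y → decodeFin (k ∘ fsuc) y j) (cong proj₂ (remQuot-combine (i fzero) _)))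
  (decodeFin-encodeFin (k ∘ fsuc) (i ∘ fsuc) j)

prodF-cong : {k k′ : Fin m → ℕ} → (∀ j → k j ≡ k′ j) → prodF k ≡ prodF k′
prodF-cong {zero}  eq = refl
prodF-cong {suc m} eq = cong₂ _*_ (eq fzero) (prodF-cong (eq ∘ fsuc))

encode-cong : {k k′ : Fin m → ℕ} → (∀ j → k j ≡ k′ j) → {i : Digits k} {i′ : Digits k′} →
  (∀ j → toℕ (i j) ≡ toℕ (i′ j)) → encode k i ≡ encode k′ i′
encode-cong {zero}  eqk eqi = refl
encode-cong {suc m} eqk eqi =
  cong₂ _+_ (cong₂ _*_ (eqi fzero) (prodF-cong (eqk ∘ fsuc))) (encode-cong (eqk ∘ fsuc) (eqi ∘ fsuc))

digit-cast : {k : Fin m → ℕ} (i : Digits k) {a b : Fin m} → a ≡ b → .(p : k a ≡ k b) → cast p (i a) ≡ i b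
digit-cast i refl p = cast-is-id p (i _)

module _ (k : Fin m → ℕ) (ρ : Permutation′ m) where

  private
    kρ : Fin m → ℕ
    kρ = k ∘ (ρ ⟨$⟩ˡ_)

  shuffleDigits : Digits k → Digits kρ
  shuffleDigits i = i ∘ (ρ ⟨$⟩ˡ_)

  unshuffleDigits : Digits kρ → Digits k
  unshuffleDigits i j = cast (cong k (inverseˡ ρ)) (i (ρ ⟨$⟩ʳ j))

  shuffleFin : Fin (prodF k) → Fin (prodF kρ)
  shuffleFin = encodeFin kρ ∘ shuffleDigits ∘ decodeFin k

  unshuffleFin : Fin (prodF kρ) → Fin (prodF k)
  unshuffleFin = encodeFin k ∘ unshuffleDigits ∘ decodeFin kρ

  unshuffleFin-shuffleFin : ∀ x → unshuffleFin (shuffleFin x) ≡ x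
  unshuffleFin-shuffleFin x = trans
    (encodeFin-cong k λ j → trans
      (cong (cast _) (decodeFin-encodeFin kρ (shuffleDigits (decodeFin k x)) (ρ ⟨$⟩ʳ j)))
      (digit-cast (decodeFin k x) (inverseˡ ρ) _))
    (encodeFin-decodeFin k x)

  shuffleFin-unshuffleFin : ∀ y → shuffleFin (unshuffleFin y) ≡ y
  shuffleFin-unshuffleFin y = trans
    (encodeFin-cong kρ λ j → trans
      (decodeFin-encodeFin k (unshuffleDigits (decodeFin kρ y)) (ρ ⟨$⟩ˡ j))
      (digit-cast (decodeFin kρ y) (inverseʳ ρ) _))
    (encodeFin-decodeFin kρ y)

  shuffleBetween : Permutation (prodF k) (prodF kρ)
  shuffleBetween = permutation shuffleFin unshuffleFin shuffleFin-unshuffleFin unshuffleFin-shuffleFin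

  prodF-reindex : prodF k ≡ prodF kρ
  prodF-reindex = ↔⇒≡ shuffleBetween

  shuffle : prodF k ≡ N → Permutation′ N
  shuffle hN = cast-id (sym hN) ∘ₚ shuffleBetween ∘ₚ cast-id (trans (sym prodF-reindex) hN)

  shuffle-isShuffle : (hN : prodF k ≡ N) → IsShuffle N k ρ (shuffle hN)
  shuffle-isShuffle hN x i x≡i = begin
    toℕ (shuffle hN ⟨$⟩ʳ x)               ≡⟨ toℕ-cast _ _ ⟩
    toℕ (shuffleFin x₀)                   ≡⟨ cong toℕ (encodeFin-cong kρ digits₀) ⟩
    toℕ (encodeFin kρ (shuffleDigits i))  ≡⟨ toℕ-encodeFin kρ _ ⟩
    encode kρ (shuffleDigits i)           ∎
    where
    x₀ = cast (sym hN) x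
    x₀≡ : x₀ ≡ encodeFin k i
    x₀≡ = toℕ-injective (trans (toℕ-cast _ x) (trans x≡i (sym (toℕ-encodeFin k i))))
    digits₀ : ∀ j → decodeFin k x₀ (ρ ⟨$⟩ˡ j) ≡ i (ρ ⟨$⟩ˡ j)
    digits₀ j = trans (cong (λ y → decodeFin k y (ρ ⟨$⟩ˡ j)) x₀≡) (decodeFin-encodeFin k i (ρ ⟨$⟩ˡ j))

IsShuffle-cong : {k k′ : Fin m → ℕ} {ρ : Permutation′ m} {π : Permutation′ N} →
  (∀ j → k j ≡ k′ j) → IsShuffle N k ρ π → IsShuffle N k′ ρ π
IsShuffle-cong {k = k} {k′} {ρ} eq πsh x i′ x≡i′ =
  trans (πsh x i (trans x≡i′ (sym i≡i′))) (encode-cong (eq ∘ (ρ ⟨$⟩ˡ_)) (λ j → toℕ-cast _ (i′ (ρ ⟨$⟩ˡ j))))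
  where
  i : Digits k
  i j = cast (sym (eq j)) (i′ j)
  i≡i′ : encode k i ≡ encode k′ i′
  i≡i′ = encode-cong eq (λ j → toℕ-cast _ (i′ j))

IsShuffle-∘ : {k : Fin m → ℕ} {τ ρ : Permutation′ m} {h g : Permutation′ N} →
  IsShuffle N k τ h → IsShuffle N (k ∘ (τ ⟨$⟩ˡ_)) ρ g → IsShuffle N k (τ ∘ₚ ρ) (h ∘ₚ g)
IsShuffle-∘ {τ = τ} {h = h} hsh gsh x i x≡i = gsh (h ⟨$⟩ʳ x) (i ∘ (τ ⟨$⟩ˡ_)) (hsh x i x≡i)

IsGenerator⇒InK-reindex : (k : Fin m → ℕ) (σ : Permutation′ m) → prodF k ≡ N →
  {π : Permutation′ N} → IsGenerator N k π → InK N (k ∘ (σ ⟨$⟩ˡ_)) π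
IsGenerator⇒InK-reindex k σ hN {π} (ρ , πsh) =
  ext (comp (inv h∈K′) h∘π∈K′) (λ x → cong (π ⟨$⟩ʳ_) (inverseʳ h))
  where
  kσ : Fin _ → ℕ
  kσ = k ∘ (σ ⟨$⟩ˡ_)
  hN′ : prodF kσ ≡ _
  hN′ = trans (sym (prodF-reindex k σ)) hN
  h : Permutation′ _
  h = shuffle kσ (flip σ) hN′
  hsh : IsShuffle _ kσ (flip σ) h
  hsh = shuffle-isShuffle kσ (flip σ) hN′
  πsh′ : IsShuffle _ (kσ ∘ (flip σ ⟨$⟩ˡ_)) ρ π
  πsh′ = IsShuffle-cong {ρ = ρ} {π = π} (λ j → cong k (sym (inverseˡ σ))) πsh
  h∈K′ : InK _ kσ h
  h∈K′ = gen {π = h} (flip σ , hsh)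
  h∘π∈K′ : InK _ kσ (h ∘ₚ π)
  h∘π∈K′ = gen {π = h ∘ₚ π} (flip σ ∘ₚ ρ , IsShuffle-∘ {τ = flip σ} {ρ} {h} {π} hsh πsh′)

InK-reindex : (k : Fin m → ℕ) (σ : Permutation′ m) → prodF k ≡ N →
  {π : Permutation′ N} → InK N k π → InK N (k ∘ (σ ⟨$⟩ˡ_)) π
InK-reindex k σ hN {π} (gen πgen) = IsGenerator⇒InK-reindex k σ hN {π} πgen
InK-reindex k σ hN one            = one
InK-reindex k σ hN (comp p q)     = comp (InK-reindex k σ hN p) (InK-reindex k σ hN q)
InK-reindex k σ hN (inv p)        = inv (InK-reindex k σ hN p)
InK-reindex k σ hN (ext p π≈τ)    = ext (InK-reindex k σ hN p) π≈τ

InK-cong : {k k′ : Fin m → ℕ} → (∀ j → k j ≡ k′ j) → {π : Permutation′ N} → InK N k π → InK N k′ π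
InK-cong eq {π} (gen (ρ , πsh)) = gen {π = π} (ρ , IsShuffle-cong {ρ = ρ} {π = π} eq πsh)
InK-cong eq one                 = one
InK-cong eq (comp p q)          = comp (InK-cong eq p) (InK-cong eq q)
InK-cong eq (inv p)             = inv (InK-cong eq p)
InK-cong eq (ext p π≈τ)         = ext (InK-cong eq p) π≈τ

theorem4p3 : (m : ℕ) → 2 ≤ m → (n : Fin m → ℕ) → (∀ j → 2 ≤ n j) →
    (σ : Permutation′ m) → (π : Permutation′ (prodF n)) →
    (InK (prodF n) n π → InK (prodF n) (λ j → n (σ ⟨$⟩ˡ j)) π)
    × (InK (prodF n) (λ j → n (σ ⟨$⟩ˡ j)) π → InK (prodF n) n π)
theorem4p3 m _ n _ σ π =
  InK-reindex n σ refl ,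
  InK-cong (λ j → cong n (inverseˡ σ)) ∘ InK-reindex (n ∘ (σ ⟨$⟩ˡ_)) (flip σ) (sym (prodF-reindex n σ))
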